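{- Every delay rule $r$ of the form $h\;{:}{ - }\;\ominus a$ admits an equivalent automaton $A$ on assignments (reading assignments to $a$ and outputting assignments to $h$) whose semiautomaton is a flip-flop semiautomaton composed with an input function; i.e., for every interpretation $I$ and time $t$, $(r,I,t)\models h$ if and only if $(A,I,t)\vdash h$.
   Context: For the single-rule program $r$ with input variable $a$, an interpretation is a finite non-empty sequence $I=I_1,\dots,I_\ell$ of subsets of $\{a\}$; $(r,I,t)\models a$ iff $a\in I_t$, and $(r,I,t)\models h$ iff $(r,I,t-1)\models a$. A semiautomaton is $\langle\Sigma,Q,\delta\rangle$ with $\delta:Q\times\Sigma\to Q$; composition of an input function $\phi:\Sigma\to\Pi$ with $\langle\Pi,Q,\delta\rangle$ is $\langle\Sigma,Q,\delta_\phi\rangle$, $\delta_\phi(q,\sigma)=\delta(q,\phi(\sigma))$. A flip-flop semiautomaton is (isomorphic to) the canonical flip-flop: inputs $\{set,reset,read\}$, states $\{high,low\}$, $\delta(q,read)=q$, $\delta(q,set)=high$, $\delta(q,reset)=low$. An automaton is $\langle\Sigma,Q,\delta,q_{\mathrm{init}},\Gamma,\theta\rangle$ with $\theta:Q\times\Sigma\to\Gamma$; on $\sigma_1\dots\sigma_\ell$ its states are $q_0=q_{\mathrm{init}}$, $q_i=\delta(q_{i-1},\sigma_i)$, and upon reading $\sigma_i$ it outputs $\theta(q_{i-1},\sigma_i)$. An automaton on assignments has $\Sigma=\{0,1\}^m$, $\Gamma=\{0,1\}^k$ read as assignments to ordered input and output variables; strings are identified with interpretations; $(A,I,t)\vdash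 b$ iff the output upon reading the $t$-th letter assigns $1$ to $b$. -}

module Defs where

open import Data.Bool using (Bool; true; false)
open import Data.Nat using (ℕ; zero; suc; _≤_; _∸_)
open import Data.Empty using (⊥)
open import Data.Fin using (Fin; zero; suc)
open import Data.Vec using (Vec; []; _∷_; lookup; replicate)
open import Data.List using (List; []; _∷_; length)
open import Data.Product using (Σ; ∃; _×_; _,_)
open import Function.Bundles using (_⤖_; Bijection)
open import Relation.Binary.PropositionalEquality using (_≡_)

record Semiautomaton : Set₁ where
  field
    Inp   : Set
    State : Set
    δ     : State → Inp → State

compose : (Σ' : Set) (D : Semiautomaton) → (Σ' → Semiautomaton.Inp D) → Semiautomaton
compose Σ' D φ = record { Inp = Σ' ; State = Semiautomaton.State D
                        ; δ = λ q σ → Semiautomaton.δ D q (φ σ) }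

data FFInput : Set where
  set reset read : FFInput

data FFState : Set where
  high low : FFState

ffδ : FFState → FFInput → FFState
ffδ q read  = q
ffδ q set   = high
ffδ q reset = low

canonicalFlipFlop : Semiautomaton
canonicalFlipFlop = record { Inp = FFInput ; State = FFState ; δ = ffδ }

record _≅_ (D E : Semiautomaton) : Set where
  open Semiautomaton
  field
    inpIso   : Inp D ⤖ Inp E
    stateIso : State D ⤖ State E
    commutes : ∀ q σ → Bijection.to stateIso (δ D q σ)
                       ≡ δ E (Bijection.to stateIso q) (Bijection.to inpIso σ)

IsFlipFlop : Semiautomaton → Set
IsFlipFlop D = D ≅ canonicalFlipFlop

record Automaton (Σ' Γ : Set) : Set₁ where
  field
    State : Set
    δ     : State → Σ' → State
    qinit : State
    θ     : State → Σ' → Γ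

  semi : Semiautomaton
  semi = record { Inp = Σ' ; State = State ; δ = δ }

AutomatonOnAssignments : ℕ → ℕ → Set₁
AutomatonOnAssignments m k = Automaton (Vec Bool m) (Vec Bool k)

FlipFlopWithInputFunction : ∀ {Σ' Γ} → Automaton Σ' Γ → Set₁
FlipFlopWithInputFunction {Σ'} A =
  Σ Set λ Π → Σ (Automaton.State A → Π → Automaton.State A) λ δ' →
    IsFlipFlop (record { Inp = Π ; State = Automaton.State A ; δ = δ' }) ×
    Σ (Σ' → Π) λ φ → ∀ q σ → Automaton.δ A q σ ≡ δ' q (φ σ)

-- Interpretations over the single input variable a: a non-empty finite
-- sequence I₁ … I_ℓ of subsets of {a}; each subset is encoded by the
-- Boolean "a ∈ I_t", i.e. as the assignment (Vec Bool 1) to (a).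
-- Non-emptiness is an explicit hypothesis (1 ≤ length I) in the statement.
Interp : Set
Interp = List (Vec Bool 1)

-- t-th letter (1-indexed) of a sequence, with a default for out-of-range t
nth : ∀ {X : Set} → X → List X → ℕ → X
nth d []       _             = d
nth d (x ∷ _)  (suc zero)    = x
nth d (_ ∷ xs) (suc (suc n)) = nth d xs (suc n)
nth d (_ ∷ _)  zero          = d

-- (r , I , t) ⊨ a   iff  a ∈ I_t   (time 0 does not exist: false)
satA : Interp → ℕ → Set
satA I zero    = ⊥
satA I (suc n) = lookup (nth (false ∷ []) I (suc n)) zero ≡ true

-- (r , I , t) ⊨ h   iff  (r , I , t-1) ⊨ a ;   for t = 1 there is no time 0, so false
satH : Interp → ℕ → Set
satH I zero    = ⊥
satH I (suc n) = satA I n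

run : ∀ {Σ' Γ} (A : Automaton Σ' Γ) → Automaton.State A → List Σ' → ℕ → Automaton.State A
run A q _        zero    = q
run A q []       (suc n) = q
run A q (σ ∷ σs) (suc n) = run A (Automaton.δ A q σ) σs n

outputAt : ∀ {m k} (A : AutomatonOnAssignments m k) → List (Vec Bool m) → ℕ → Vec Bool k
outputAt A I t = Automaton.θ A (run A (Automaton.qinit A) I (t ∸ 1)) (nth (replicate _ false) I t)

derivesH : AutomatonOnAssignments 1 1 → Interp → ℕ → Set
derivesH A I t = lookup (outputAt A I t) zero ≡ true

{-# OPTIONS --safe #-}
module Submission where

-- The delay automaton stores the last value of a in a flip-flop (set on a, reset on ¬a) and
-- outputs the stored bit before reading the next letter; so the output at time t is the
-- value of a at time t − 1, and at time 1 it is the initial state low.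

open import Defs
open import Data.Nat using (ℕ; _≤_; zero; suc; s≤s)
open import Data.Nat.Properties using (≤-trans; n≤1+n)
open import Data.List using (length; _∷_)
open import Data.Product using (Σ; _×_; _,_)
open import Function.Bundles using (_⇔_; mk⇔)
open import Data.Bool using (Bool; true; false)
open import Data.Vec using (Vec; []; _∷_; lookup)
open import Data.Fin using (zero)
open import Relation.Binary.PropositionalEquality using (_≡_; refl; sym; trans)
open import Function.Construct.Identity using (⤖-id)

setIf : Vec Bool 1 → FFInput
setIf (true ∷ [])  = set
setIf (false ∷ []) = reset

isHigh : FFState → Bool
isHigh high = true
isHigh low  = false

delayAutomaton : AutomatonOnAssignments 1 1
delayAutomaton = record
  { State = FFState
  ; δ     = λ q σ → ffδ q (setIf σ)
  ; qinit = low
  ; θ     = λ q _ → isHigh q ∷ []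
  }

delayAutomaton-flipFlop : FlipFlopWithInputFunction delayAutomaton
delayAutomaton-flipFlop =
  FFInput , ffδ ,
  record { inpIso = ⤖-id _ ; stateIso = ⤖-id _ ; commutes = λ _ _ → refl } ,
  setIf , λ _ _ → refl

isHigh-run≡last : ∀ q (I : Interp) n → suc n ≤ length I →
                  isHigh (run delayAutomaton q I (suc n)) ≡ lookup (nth (false ∷ []) I (suc n)) zero
isHigh-run≡last q ((true ∷ [])  ∷ _) zero    _       = refl
isHigh-run≡last q ((false ∷ []) ∷ _) zero    _       = refl
isHigh-run≡last q (σ ∷ I)            (suc n) (s≤s p) = isHigh-run≡last (ffδ q (setIf σ)) I n p

satH⇔derivesH : (I : Interp) (t : ℕ) → t ≤ length I → satH I t ⇔ derivesH delayAutomaton I t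
satH⇔derivesH I zero          _ = mk⇔ (λ ()) (λ ())
satH⇔derivesH I (suc zero)    _ = mk⇔ (λ ()) (λ ())
satH⇔derivesH I (suc (suc n)) p =
  mk⇔ (trans output≡a) (trans (sym output≡a))
  where
  output≡a : isHigh (run delayAutomaton low I (suc n)) ≡ lookup (nth (false ∷ []) I (suc n)) zero
  output≡a = isHigh-run≡last low I n (≤-trans (n≤1+n _) p)

lemma1 : Σ (AutomatonOnAssignments 1 1) λ A →
             FlipFlopWithInputFunction A ×
             ((I : Interp) → 1 ≤ length I → (t : ℕ) → 1 ≤ t → t ≤ length I →
               (satH I t ⇔ derivesH A I t))
lemma1 = delayAutomaton , delayAutomaton-flipFlop , λ I _ t _ → satH⇔derivesH I t
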